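{- Let $l,m,n$ be nonnegative integers with $m\geqslant 1$, and let $\phi$ be an $(l,m,n)$-assignment. Then $\phi$ has maximum value among all $(l,m,n)$-assignments if and only if there is no positive extender $\tau$ that is compatible with $\phi$.
   Context: Let $M=\{1,\ldots,m\}$ and $\mathbb{N}=\{0,1,2,\ldots\}$. An $(l,m,n)$-assignment is a function $\phi:2^M\to\mathbb{N}$ such that $\sum_{A\subseteq M}\phi(A)=n$; the quantity $\sum_{A\ni x}\phi(A)$ is the same for every $x\in M$ (this common number is the value $v(\phi)$); and $\sum_{A\supseteq\{x,y\}}\phi(A)=l$ for all distinct $x,y\in M$. An extender is a function $\tau:2^M\to\mathbb{Z}$ such that $\sum_{A\subseteq M}\tau(A)=0$; the quantity $\sum_{A\ni x}\tau(A)$ is the same for all $x\in M$ (its value $v(\tau)$); and $\sum_{A\supseteq\{x,y\}}\tau(A)=0$ for all distinct $x,y\in M$. An extender is positive if $v(\tau)>0$. An extender $\tau$ is compatible with an assignment $\phi$ if $\phi+\tau$ is again an assignment, i.e. $\phi(A)+\tau(A)\geqslant 0$ for all $A\subseteq M$. -}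

module Defs where

open import Data.Bool using (Bool; true; false)
open import Data.Nat as ℕ using (ℕ)
open import Data.Integer as ℤ using (ℤ; +_)
open import Data.Fin using (Fin)
open import Data.Fin.Subset using (Subset; _∈_; outside; inside)
open import Data.Fin.Subset.Properties using (_∈?_)
open import Data.List using (List; []; _∷_; map; _++_; filter; foldr)
open import Data.Vec using (_∷_; [])
open import Data.Product using (_×_; Σ)
open import Relation.Nullary.Decidable using (_×-dec_)
open import Relation.Binary.PropositionalEquality using (_≡_; _≢_)

-- M = {1,…,m} is modelled as Fin m; subsets of M as Subset m (= Vec Bool m).

allSubsets : (m : ℕ) → List (Subset m)
allSubsets ℕ.zero = [] ∷ []
allSubsets (ℕ.suc m) =
  map (outside ∷_) (allSubsets m) ++ map (inside ∷_) (allSubsets m)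

sumℕ : List ℕ → ℕ
sumℕ = foldr ℕ._+_ 0

sumℤ : List ℤ → ℤ
sumℤ = foldr ℤ._+_ (+ 0)

ΣAllℕ : {m : ℕ} → (Subset m → ℕ) → ℕ
ΣAllℕ {m} f = sumℕ (map f (allSubsets m))

ΣAllℤ : {m : ℕ} → (Subset m → ℤ) → ℤ
ΣAllℤ {m} f = sumℤ (map f (allSubsets m))

Σ∋ℕ : {m : ℕ} → (Subset m → ℕ) → Fin m → ℕ
Σ∋ℕ {m} f x = sumℕ (map f (filter (x ∈?_) (allSubsets m)))

Σ∋ℤ : {m : ℕ} → (Subset m → ℤ) → Fin m → ℤ
Σ∋ℤ {m} f x = sumℤ (map f (filter (x ∈?_) (allSubsets m)))

Σ∋₂ℕ : {m : ℕ} → (Subset m → ℕ) → Fin m → Fin m → ℕ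
Σ∋₂ℕ {m} f x y =
  sumℕ (map f (filter (λ A → (x ∈? A) ×-dec (y ∈? A)) (allSubsets m)))

Σ∋₂ℤ : {m : ℕ} → (Subset m → ℤ) → Fin m → Fin m → ℤ
Σ∋₂ℤ {m} f x y =
  sumℤ (map f (filter (λ A → (x ∈? A) ×-dec (y ∈? A)) (allSubsets m)))

record IsAssignment (l m n : ℕ) (φ : Subset m → ℕ) (v : ℕ) : Set where
  field
    total   : ΣAllℕ φ ≡ n
    uniform : (x : Fin m) → Σ∋ℕ φ x ≡ v
    pairs   : (x y : Fin m) → x ≢ y → Σ∋₂ℕ φ x y ≡ l

record IsExtender (m : ℕ) (τ : Subset m → ℤ) (v : ℤ) : Set where
  field
    total   : ΣAllℤ τ ≡ + 0
    uniform : (x : Fin m) → Σ∋ℤ τ x ≡ v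
    pairs   : (x y : Fin m) → x ≢ y → Σ∋₂ℤ τ x y ≡ + 0

Compatible : {m : ℕ} → (Subset m → ℕ) → (Subset m → ℤ) → Set
Compatible {m} φ τ = (A : Subset m) → + 0 ℤ.≤ (+ φ A) ℤ.+ τ A

HasMaxValue : (l m n : ℕ) → ℕ → Set
HasMaxValue l m n v = (ψ : Subset m → ℕ) (w : ℕ) → IsAssignment l m n ψ w → w ℕ.≤ v

ExistsPositiveCompatibleExtender : {m : ℕ} → (Subset m → ℕ) → Set
ExistsPositiveCompatibleExtender {m} φ =
  Σ (Subset m → ℤ) λ τ → Σ ℤ λ t → IsExtender m τ t × (+ 0 ℤ.< t) × Compatible φ τ

-- The whole proof rests
-- on one linearity fact, `sum-split`: if ψ = φ + τ pointwise then, over any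
-- list of subsets, Σψ = Σφ + Στ.
-- The theorem follows: a compatible positive extender produces an assignment of
-- larger value, and an assignment of larger value produces a compatible
-- positive extender.

module Submission where

open import Defs
open import Data.Nat using (ℕ; _≥_)
open import Data.Fin.Subset using (Subset)
open import Relation.Nullary using (¬_; yes; no)
open import Data.Product using (_×_; _,_)

import Data.Nat as ℕ
import Data.Nat.Properties as ℕP
open import Data.Integer as ℤ using (ℤ; +_; ∣_∣; _-_; +<+; +≤+)
import Data.Integer.Properties as ℤP
open import Data.Integer.Tactic.RingSolver using (solve-∀)
open import Data.List using (List; []; _∷_; map; filter)
open import Data.Fin using (Fin)
open import Data.Fin.Subset.Properties using (_∈?_)
open import Relation.Nullary.Decidable using (_×-dec_)
open import Relation.Binary.PropositionalEquality
  using (_≡_; refl; sym; trans; cong; cong₂; subst; subst₂; module ≡-Reasoning)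
open import Data.Empty using (⊥-elim)

containing : {m : ℕ} → Fin m → List (Subset m)
containing {m} x = filter (x ∈?_) (allSubsets m)

containing₂ : {m : ℕ} → Fin m → Fin m → List (Subset m)
containing₂ {m} x y = filter (λ A → (x ∈? A) ×-dec (y ∈? A)) (allSubsets m)

add-sub-cancel : ∀ a b → (a ℤ.+ b) - a ≡ b
add-sub-cancel = solve-∀

add-difference : ∀ a b → a ℤ.+ (b - a) ≡ b
add-difference = solve-∀

sum-split : {X : Set} (φ ψ : X → ℕ) (τ : X → ℤ) →
  (∀ A → + ψ A ≡ + φ A ℤ.+ τ A) → (L : List X) →
  + sumℕ (map ψ L) ≡ + sumℕ (map φ L) ℤ.+ sumℤ (map τ L)
sum-split φ ψ τ split [] = refl
sum-split φ ψ τ split (A ∷ L) = begin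
  + (ψ A ℕ.+ Σψ)                    ≡⟨ ℤP.pos-+ (ψ A) Σψ ⟩
  + ψ A ℤ.+ + Σψ                    ≡⟨ cong₂ ℤ._+_ (split A) (sum-split φ ψ τ split L) ⟩
  (+ φ A ℤ.+ τ A) ℤ.+ (+ Σφ ℤ.+ Στ) ≡⟨ interchange (+ φ A) (τ A) (+ Σφ) Στ ⟩
  (+ φ A ℤ.+ + Σφ) ℤ.+ (τ A ℤ.+ Στ) ≡⟨ cong (ℤ._+ (τ A ℤ.+ Στ)) (sym (ℤP.pos-+ (φ A) Σφ)) ⟩
  + (φ A ℕ.+ Σφ) ℤ.+ (τ A ℤ.+ Στ)   ∎
  where
  open ≡-Reasoning
  Σψ Σφ : ℕ
  Σψ = sumℕ (map ψ L)
  Σφ = sumℕ (map φ L)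
  Στ : ℤ
  Στ = sumℤ (map τ L)
  interchange : ∀ a b c d → (a ℤ.+ b) ℤ.+ (c ℤ.+ d) ≡ (a ℤ.+ c) ℤ.+ (b ℤ.+ d)
  interchange = solve-∀

add-extender : {l m n v w : ℕ} {t : ℤ} (φ ψ : Subset m → ℕ) (τ : Subset m → ℤ) →
  IsAssignment l m n φ v → IsExtender m τ t →
  (∀ A → + ψ A ≡ + φ A ℤ.+ τ A) → + w ≡ + v ℤ.+ t →
  IsAssignment l m n ψ w
add-extender {l} {m} {n} {v} {w} φ ψ τ aφ eτ split w≡v+t = record
  { total   = ℤP.+-injective (shifted (allSubsets m) Aφ.total Eτ.total (sym (ℤP.+-identityʳ (+ n))))
  ; uniform = λ x → ℤP.+-injective (shifted (containing x) (Aφ.uniform x) (Eτ.uniform x) w≡v+t)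
  ; pairs   = λ x y x≢y → ℤP.+-injective
      (shifted (containing₂ x y) (Aφ.pairs x y x≢y) (Eτ.pairs x y x≢y) (sym (ℤP.+-identityʳ (+ l))))
  }
  where
  module Aφ = IsAssignment aφ
  module Eτ = IsExtender eτ
  shifted : (L : List (Subset m)) {a c : ℕ} {b : ℤ} →
    sumℕ (map φ L) ≡ a → sumℤ (map τ L) ≡ b → + c ≡ + a ℤ.+ b →
    + sumℕ (map ψ L) ≡ + c
  shifted L refl refl c≡a+b = trans (sum-split φ ψ τ split L) (sym c≡a+b)

difference-extender : {l m n v w : ℕ} (φ ψ : Subset m → ℕ) (τ : Subset m → ℤ) →
  IsAssignment l m n φ v → IsAssignment l m n ψ w →
  (∀ A → + ψ A ≡ + φ A ℤ.+ τ A) →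
  IsExtender m τ (+ w - + v)
difference-extender {l} {m} {n} φ ψ τ aφ aψ split = record
  { total   = trans (difference (allSubsets m) Aφ.total Aψ.total) (ℤP.+-inverseʳ (+ n))
  ; uniform = λ x → difference (containing x) (Aφ.uniform x) (Aψ.uniform x)
  ; pairs   = λ x y x≢y →
      trans (difference (containing₂ x y) (Aφ.pairs x y x≢y) (Aψ.pairs x y x≢y)) (ℤP.+-inverseʳ (+ l))
  }
  where
  module Aφ = IsAssignment aφ
  module Aψ = IsAssignment aψ
  solve-for-τ : ∀ a b c → c ≡ a ℤ.+ b → b ≡ c - a
  solve-for-τ a b c refl = sym (add-sub-cancel a b)
  difference : (L : List (Subset m)) {a c : ℕ} →
    sumℕ (map φ L) ≡ a → sumℕ (map ψ L) ≡ c → sumℤ (map τ L) ≡ + c - + a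
  difference L refl refl = solve-for-τ (+ sumℕ (map φ L)) _ _ (sum-split φ ψ τ split L)

difference-compatible : {m : ℕ} (φ ψ : Subset m → ℕ) →
  Compatible φ (λ A → + ψ A - + φ A)
difference-compatible φ ψ A =
  subst (+ 0 ℤ.≤_) (sym (add-difference (+ φ A) (+ ψ A))) (+≤+ ℕ.z≤n)

positive-shift : {v w : ℕ} {t : ℤ} → + w ≡ + v ℤ.+ t → + 0 ℤ.< t → v ℕ.< w
positive-shift {v} w≡v+t 0<t = ℤP.drop‿+<+
  (subst₂ ℤ._<_ (ℤP.+-identityʳ (+ v)) (sym w≡v+t) (ℤP.+-monoʳ-< (+ v) 0<t))

positive-difference : {v w : ℕ} → v ℕ.< w → + 0 ℤ.< + w - + v
positive-difference {v} {w} v<w =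
  subst (+ 0 ℤ.<_) (sym (trans (ℤP.[+m]-[+n]≡m⊖n w v) (ℤP.⊖-≥ (ℕP.<⇒≤ v<w))))
    (+<+ (ℕP.m<n⇒0<n∸m v<w))

lemma5p1 : (l m n : ℕ) → m ≥ 1 → (φ : Subset m → ℕ) (v : ℕ) →
    IsAssignment l m n φ v →
    (HasMaxValue l m n v → ¬ ExistsPositiveCompatibleExtender φ) ×
    (¬ ExistsPositiveCompatibleExtender φ → HasMaxValue l m n v)
lemma5p1 l m n _ φ v aφ = maximal⇒no-extender , no-extender⇒maximal
  where
  maximal⇒no-extender : HasMaxValue l m n v → ¬ ExistsPositiveCompatibleExtender φ
  maximal⇒no-extender maximal (τ , t , eτ , 0<t , compatible) =
    ℕP.<⇒≱ (positive-shift w≡v+t 0<t) (maximal ψ _ aψ)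
    where
    ψ : Subset m → ℕ
    ψ A = ∣ + φ A ℤ.+ τ A ∣
    w≡v+t : + ∣ + v ℤ.+ t ∣ ≡ + v ℤ.+ t
    w≡v+t = ℤP.0≤i⇒+∣i∣≡i (ℤP.≤-trans (+≤+ ℕ.z≤n) (ℤP.i≤i+j (+ v) t {{ℤ.nonNegative (ℤP.<⇒≤ 0<t)}}))
    aψ : IsAssignment l m n ψ ∣ + v ℤ.+ t ∣
    aψ = add-extender φ ψ τ aφ eτ (λ A → ℤP.0≤i⇒+∣i∣≡i (compatible A)) w≡v+t
  no-extender⇒maximal : ¬ ExistsPositiveCompatibleExtender φ → HasMaxValue l m n v
  no-extender⇒maximal no-extender ψ w aψ with w ℕP.≤? v
  ... | yes w≤v = w≤v
  ... | no w≰v = ⊥-elim (no-extender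
    (τ , + w - + v , difference-extender φ ψ τ aφ aψ split ,
     positive-difference (ℕP.≰⇒> w≰v) , difference-compatible φ ψ))
    where
    τ : Subset m → ℤ
    τ A = + ψ A - + φ A
    split : ∀ A → + ψ A ≡ + φ A ℤ.+ τ A
    split A = sym (add-difference (+ φ A) (+ ψ A))
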